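{- Let $G$ be a graph with hereditary density $\delta$. (1) Any schedule of direct message exchanges that solves the NeighborExchange problem on $G$ takes at least $\delta$ rounds. (2) There exists a schedule of the edges of $G$ such that each node needs only $2\delta$ direct message exchanges to solve the NeighborExchange problem.
   Context: The hereditary density $\delta$ of $G$ is the minimal integer such that for every subset $S$ of nodes, the subgraph induced by $S$ has at most $\delta|S|$ edges. In the NeighborExchange problem, each node has an initial message and every node must obtain the initial messages of all of its neighbors. A schedule of direct message exchanges proceeds in synchronous rounds in which each node initiates a bidirectional exchange with at most one neighbor, and information is only exchanged directly (not forwarded): it solves NeighborExchange iff every edge $\{u,v\}$ of $G$ is used by an exchange initiated by $u$ or by $v$. Part (2) asserts the existence of an assignment of each edge to one of its endpoints (the initiator) such that every node is assigned at most $2\delta$ edges. -}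

module Defs where

open import Data.Nat using (ℕ; zero; suc; _+_; _*_; _≤_)
open import Data.Bool using (Bool; true; false; if_then_else_; _∧_)
open import Data.Fin using (Fin; zero; suc; _<?_)
open import Data.Maybe using (Maybe; just; nothing)
open import Data.Product using (Σ; _×_; _,_; ∃-syntax)
open import Data.Sum using (_⊎_)
open import Relation.Nullary.Decidable using (⌊_⌋)
open import Relation.Binary.PropositionalEquality using (_≡_)

countTrue : ∀ {m} → (Fin m → Bool) → ℕ
countTrue {zero}  f = 0
countTrue {suc m} f = (if f zero then 1 else 0) + countTrue (λ i → f (suc i))

sumFin : ∀ {m} → (Fin m → ℕ) → ℕ
sumFin {zero}  f = 0
sumFin {suc m} f = f zero + sumFin (λ i → f (suc i))

record Graph : Set where
  field
    n      : ℕ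
    adj    : Fin n → Fin n → Bool
    sym    : ∀ u v → adj u v ≡ adj v u
    irrefl : ∀ u → adj u u ≡ false
open Graph public

NodeSet : Graph → Set
NodeSet G = Fin (n G) → Bool

size : (G : Graph) → NodeSet G → ℕ
size G S = countTrue S

-- number of edges of the subgraph induced by S (each edge {u,v} counted once, via u < v)
edgesIn : (G : Graph) → NodeSet G → ℕ
edgesIn G S = sumFin (λ u → countTrue (λ v → S u ∧ S v ∧ adj G u v ∧ ⌊ u <? v ⌋))

DensityBound : Graph → ℕ → Set
DensityBound G d = ∀ (S : NodeSet G) → edgesIn G S ≤ d * size G S

IsHereditaryDensity : Graph → ℕ → Set
IsHereditaryDensity G δ = DensityBound G δ × (∀ d → DensityBound G d → δ ≤ d)

-- A schedule of T synchronous rounds: in round r, node u initiates a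
-- (bidirectional) direct exchange with at most one node (nothing = idle),
-- which must be a neighbour.
record Schedule (G : Graph) (T : ℕ) : Set where
  field
    initiate : Fin T → Fin (n G) → Maybe (Fin (n G))
    toNeighbour : ∀ r u v → initiate r u ≡ just v → adj G u v ≡ true
open Schedule public

SolvesNeighborExchange : (G : Graph) (T : ℕ) → Schedule G T → Set
SolvesNeighborExchange G T σ =
  ∀ u v → adj G u v ≡ true →
    ∃[ r ] (initiate σ r u ≡ just v ⊎ initiate σ r v ≡ just u)

-- An assignment of each edge to one of its endpoints (the initiator):
-- init u v ≡ true means u is the initiator of edge {u,v}.
record InitiatorAssignment (G : Graph) : Set where
  field
    init : Fin (n G) → Fin (n G) → Bool
    onlyEdges : ∀ u v → init u v ≡ true → adj G u v ≡ true
    exactlyOne : ∀ u v → adj G u v ≡ true →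
      (init u v ≡ true × init v u ≡ false) ⊎ (init u v ≡ false × init v u ≡ true)
open InitiatorAssignment public

load : (G : Graph) → InitiatorAssignment G → Fin (n G) → ℕ
load G a u = countTrue (init a u)

-- Lower bound: let a schedule of T rounds solve NeighborExchange and count the edges of an
-- induced subgraph G[S]. Each edge was used by an exchange initiated by one of its ends, and a
-- node initiates at most one exchange per round, so G[S] has at most T·|S| edges; by
-- minimality of δ, δ ≤ T.
-- Upper bound: the degrees in G[S] sum to 2|E(G[S])| ≤ 2δ|S|, so every nonempty S contains a
-- node of degree at most 2δ in G[S]. Repeatedly removing such a node and letting it initiate
-- all its remaining edges assigns every edge, with at most 2δ edges per node.
module Submission where

open import Defs hiding (sym)
open import Algebra.Properties.CommutativeSemigroup using (interchange)
open import Data.Bool using (Bool; true; false; if_then_else_; _∧_; _∨_)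
import Data.Bool.Properties as Bool
open import Data.Empty using (⊥-elim)
open import Data.Fin using (Fin; zero; suc; _<?_)
open import Data.Fin.Properties using (_≟_; any?)
import Data.Fin.Properties as Fin
open import Data.Maybe using (Maybe; just; nothing)
import Data.Maybe.Properties as Maybe
open import Data.Nat using (ℕ; zero; suc; _+_; _*_; _≤_; _<_; z≤n; s≤s; _≤?_; >-nonZero)
open import Data.Nat.Properties
  using ( ≤-refl; ≤-trans; <-irrefl; ≰⇒>; m≤n+m; n<1+n; +-mono-≤; +-suc; +-identityʳ
        ; +-commutativeSemigroup; *-comm; *-assoc; *-zeroʳ; *-identityˡ; *-identityʳ
        ; *-distribʳ-+; *-monoʳ-≤; *-monoʳ-<; suc-injective; module ≤-Reasoning )
open import Data.Product using (Σ; _×_; _,_; proj₁; proj₂; ∃-syntax)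
open import Data.Sum using (_⊎_; inj₁; inj₂)
open import Function using (_∘_; flip)
open import Relation.Binary using (tri<; tri≈; tri>)
open import Relation.Binary.PropositionalEquality
  using (_≡_; _≢_; refl; sym; trans; cong; cong₂; subst)
open import Relation.Nullary using (does; yes; no)
open import Relation.Nullary.Decidable using (⌊_⌋; _×-dec_; dec-true; dec-false)

toℕ : Bool → ℕ
toℕ b = if b then 1 else 0

∧-unzip : ∀ {a b} → a ∧ b ≡ true → a ≡ true × b ≡ true
∧-unzip {true} b≡true = refl , b≡true

true≢false : true ≢ false
true≢false ()

sumFin-cong : ∀ {m} {f g : Fin m → ℕ} → (∀ i → f i ≡ g i) → sumFin f ≡ sumFin g
sumFin-cong {zero}  f≗g = refl
sumFin-cong {suc m} f≗g = cong₂ _+_ (f≗g zero) (sumFin-cong (f≗g ∘ suc))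

sumFin-mono-≤ : ∀ {m} {f g : Fin m → ℕ} → (∀ i → f i ≤ g i) → sumFin f ≤ sumFin g
sumFin-mono-≤ {zero}  f≤g = z≤n
sumFin-mono-≤ {suc m} f≤g = +-mono-≤ (f≤g zero) (sumFin-mono-≤ (f≤g ∘ suc))

sumFin-const : ∀ m c → sumFin {m} (λ _ → c) ≡ m * c
sumFin-const zero    c = refl
sumFin-const (suc m) c = cong (c +_) (sumFin-const m c)

sumFin-+ : ∀ {m} (f g : Fin m → ℕ) → sumFin (λ i → f i + g i) ≡ sumFin f + sumFin g
sumFin-+ {zero}  f g = refl
sumFin-+ {suc m} f g =
  trans (cong (f zero + g zero +_) (sumFin-+ (f ∘ suc) (g ∘ suc)))
        (interchange +-commutativeSemigroup (f zero) (g zero) _ _)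

sumFin-swap : ∀ {m k} (f : Fin m → Fin k → ℕ) →
  sumFin (λ i → sumFin (f i)) ≡ sumFin (λ j → sumFin (λ i → f i j))
sumFin-swap {zero}  {k} f = sym (trans (sumFin-const k 0) (*-zeroʳ k))
sumFin-swap {suc m}     f =
  trans (cong (sumFin (f zero) +_) (sumFin-swap (f ∘ suc))) (sym (sumFin-+ (f zero) _))

countTrue≡sumFin : ∀ {m} (f : Fin m → Bool) → countTrue f ≡ sumFin (toℕ ∘ f)
countTrue≡sumFin {zero}  f = refl
countTrue≡sumFin {suc m} f = cong (toℕ (f zero) +_) (countTrue≡sumFin (f ∘ suc))

countTrue-false : ∀ {m} → countTrue {m} (λ _ → false) ≡ 0
countTrue-false {zero}  = refl
countTrue-false {suc m} = countTrue-false {m}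

countTrue≡0⇒false : ∀ {m} (f : Fin m → Bool) → countTrue f ≡ 0 → ∀ i → f i ≡ false
countTrue≡0⇒false {suc m} f ∣f∣≡0 i with f zero in f0
countTrue≡0⇒false {suc m} f ()    i       | true
countTrue≡0⇒false {suc m} f ∣f∣≡0 zero    | false = f0
countTrue≡0⇒false {suc m} f ∣f∣≡0 (suc i) | false = countTrue≡0⇒false (f ∘ suc) ∣f∣≡0 i

toℕ-mono : ∀ {a b} → (a ≡ true → b ≡ true) → toℕ a ≤ toℕ b
toℕ-mono {false}     a⇒b = z≤n
toℕ-mono {true} {b} a⇒b with a⇒b refl
... | refl = ≤-refl

countTrue-mono : ∀ {m} {f g : Fin m → Bool} → (∀ i → f i ≡ true → g i ≡ true) →
  countTrue f ≤ countTrue g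
countTrue-mono {zero}  f⇒g = z≤n
countTrue-mono {suc m} f⇒g = +-mono-≤ (toℕ-mono (f⇒g zero)) (countTrue-mono (f⇒g ∘ suc))

sumFin-toℕ-* : ∀ {m} (f : Fin m → Bool) c → sumFin (λ i → toℕ (f i) * c) ≡ countTrue f * c
sumFin-toℕ-* {zero}  f c = refl
sumFin-toℕ-* {suc m} f c =
  trans (cong (toℕ (f zero) * c +_) (sumFin-toℕ-* (f ∘ suc) c))
        (sym (*-distribʳ-+ c (toℕ (f zero)) (countTrue (f ∘ suc))))

countTrue-≟ : ∀ {m} (w : Fin m) → countTrue (λ v → does (w ≟ v)) ≡ 1
countTrue-≟ {suc m} zero    = cong suc (countTrue-false {m})
countTrue-≟ {suc m} (suc w) = countTrue-≟ {m} w

countTrue-≟just≤1 : ∀ {m} (x : Maybe (Fin m)) → countTrue (λ v → does (Maybe.≡-dec _≟_ x (just v))) ≤ 1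
countTrue-≟just≤1 {m} nothing = subst (_≤ 1) (sym (countTrue-false {m})) z≤n
countTrue-≟just≤1     (just w) = subst (_≤ 1) (sym (countTrue-≟ w)) ≤-refl

any : ∀ {m} → (Fin m → Bool) → Bool
any {zero}  g = false
any {suc m} g = g zero ∨ any (g ∘ suc)

any-intro : ∀ {m} (g : Fin m → Bool) i → g i ≡ true → any g ≡ true
any-intro g zero gi rewrite gi = refl
any-intro g (suc i) gi with g zero
... | true  = refl
... | false = any-intro (g ∘ suc) i gi

toℕ-any≤countTrue : ∀ {m} (g : Fin m → Bool) → toℕ (any g) ≤ countTrue g
toℕ-any≤countTrue {zero}  g = z≤n
toℕ-any≤countTrue {suc m} g with g zero
... | true  = s≤s z≤n
... | false = toℕ-any≤countTrue (g ∘ suc)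

removeNode : ∀ {m} → (Fin m → Bool) → Fin m → Fin m → Bool
removeNode S p x = if does (x ≟ p) then false else S x

removeNode-self : ∀ {m} (S : Fin m → Bool) p → removeNode S p p ≡ false
removeNode-self S p = cong (λ b → if b then false else S p) (dec-true (p ≟ p) refl)

removeNode-other : ∀ {m} (S : Fin m → Bool) {p x} → x ≢ p → removeNode S p x ≡ S x
removeNode-other S {p} {x} x≢p = cong (λ b → if b then false else S x) (dec-false (x ≟ p) x≢p)

removeNode⊆ : ∀ {m} (S : Fin m → Bool) p x → removeNode S p x ≡ true → S x ≡ true
removeNode⊆ S p x x∈S-p with x ≟ p
... | no _ = x∈S-p

countTrue-removeNode : ∀ {m} (S : Fin m → Bool) p → S p ≡ true →
  countTrue S ≡ suc (countTrue (removeNode S p))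
countTrue-removeNode S zero Sp rewrite Sp = refl
countTrue-removeNode {suc m} S (suc p) Sp =
  trans (cong (toℕ (S zero) +_) (countTrue-removeNode (S ∘ suc) p Sp)) (+-suc (toℕ (S zero)) _)

countRelated : ∀ {m} → (Fin m → Fin m → Bool) → ℕ
countRelated R = sumFin (λ u → sumFin (λ v → toℕ (R u v)))

countPairs : ∀ {m} → (Fin m → Fin m → Bool) → ℕ
countPairs R = countRelated (λ u v → R u v ∧ ⌊ u <? v ⌋)

countRelated-cong : ∀ {m} {R P : Fin m → Fin m → Bool} → (∀ u v → R u v ≡ P u v) →
  countRelated R ≡ countRelated P
countRelated-cong R≗P = sumFin-cong (λ u → sumFin-cong (λ v → cong toℕ (R≗P u v)))

countRelated-flip : ∀ {m} (R : Fin m → Fin m → Bool) → countRelated (flip R) ≡ countRelated R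
countRelated-flip R = sym (sumFin-swap (λ u v → toℕ (R u v)))

countRelated-+ : ∀ {m} (R P : Fin m → Fin m → Bool) →
  sumFin (λ u → sumFin (λ v → toℕ (R u v) + toℕ (P u v))) ≡ countRelated R + countRelated P
countRelated-+ R P =
  trans (sumFin-cong (λ u → sumFin-+ (λ v → toℕ (R u v)) (λ v → toℕ (P u v))))
        (sumFin-+ (λ u → sumFin (λ v → toℕ (R u v))) (λ u → sumFin (λ v → toℕ (P u v))))

countPairs+countPairsᵀ : ∀ {m} (R : Fin m → Fin m → Bool) →
  countPairs R + countPairs (flip R) ≡
  sumFin (λ u → sumFin (λ v → toℕ (R u v ∧ ⌊ u <? v ⌋) + toℕ (R u v ∧ ⌊ v <? u ⌋)))
countPairs+countPairsᵀ R =
  trans (cong (countPairs R +_) (countRelated-flip (λ u v → R u v ∧ ⌊ v <? u ⌋)))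
        (sym (countRelated-+ (λ u v → R u v ∧ ⌊ u <? v ⌋) (λ u v → R u v ∧ ⌊ v <? u ⌋)))

toℕ-∧<+∧>≤ : ∀ {m} b (u v : Fin m) → toℕ (b ∧ ⌊ u <? v ⌋) + toℕ (b ∧ ⌊ v <? u ⌋) ≤ toℕ b
toℕ-∧<+∧>≤ false u v = z≤n
toℕ-∧<+∧>≤ true  u v with u <? v | v <? u
... | yes u<v | yes v<u = ⊥-elim (Fin.<-asym u<v v<u)
... | yes _   | no _    = ≤-refl
... | no _    | yes _   = ≤-refl
... | no _    | no _    = z≤n

toℕ≤∧<+∧> : ∀ {m} b (u v : Fin m) → (b ≡ true → u ≢ v) →
  toℕ b ≤ toℕ (b ∧ ⌊ u <? v ⌋) + toℕ (b ∧ ⌊ v <? u ⌋)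
toℕ≤∧<+∧> false u v u≢v = z≤n
toℕ≤∧<+∧> true  u v u≢v with u <? v | v <? u
... | yes _   | _       = s≤s z≤n
... | no _    | yes _   = ≤-refl
... | no u≮v | no v≮u with Fin.<-cmp u v
...   | tri< u<v _   _   = ⊥-elim (u≮v u<v)
...   | tri≈ _   u≡v _   = ⊥-elim (u≢v refl u≡v)
...   | tri> _   _   v<u = ⊥-elim (v≮u v<u)

countPairs+countPairsᵀ≤countRelated : ∀ {m} (R : Fin m → Fin m → Bool) →
  countPairs R + countPairs (flip R) ≤ countRelated R
countPairs+countPairsᵀ≤countRelated R = begin
  countPairs R + countPairs (flip R)
    ≡⟨ countPairs+countPairsᵀ R ⟩
  _ ≤⟨ sumFin-mono-≤ (λ u → sumFin-mono-≤ (λ v → toℕ-∧<+∧>≤ (R u v) u v)) ⟩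
  countRelated R
    ∎
  where open ≤-Reasoning

countRelated≤countPairs+countPairsᵀ : ∀ {m} (R : Fin m → Fin m → Bool) →
  (∀ u → R u u ≡ false) → countRelated R ≤ countPairs R + countPairs (flip R)
countRelated≤countPairs+countPairsᵀ R R-irrefl = begin
  countRelated R
    ≤⟨ sumFin-mono-≤ (λ u → sumFin-mono-≤ (λ v → toℕ≤∧<+∧> (R u v) u v (distinct u v))) ⟩
  _ ≡⟨ sym (countPairs+countPairsᵀ R) ⟩
  countPairs R + countPairs (flip R)
    ∎
  where
  open ≤-Reasoning
  distinct : ∀ u v → R u v ≡ true → u ≢ v
  distinct u .u Ruu refl = true≢false (trans (sym Ruu) (R-irrefl u))

toℕ-∧-cover : ∀ {r a b} l → (r ≡ true → a ≡ true ⊎ b ≡ true) →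
  toℕ (r ∧ l) ≤ toℕ (a ∧ l) + toℕ (b ∧ l)
toℕ-∧-cover {false} l       cover = z≤n
toℕ-∧-cover {true}  false   cover = z≤n
toℕ-∧-cover {true}  true    cover with cover refl
... | inj₁ refl = s≤s z≤n
... | inj₂ refl = m≤n+m 1 _

countPairs-cover : ∀ {m} (R P : Fin m → Fin m → Bool) →
  (∀ u v → R u v ≡ true → P u v ≡ true ⊎ P v u ≡ true) →
  countPairs R ≤ countPairs P + countPairs (flip P)
countPairs-cover R P cover = begin
  countPairs R
    ≤⟨ sumFin-mono-≤ (λ u → sumFin-mono-≤ (λ v → toℕ-∧-cover ⌊ u <? v ⌋ (cover u v))) ⟩
  _ ≡⟨ countRelated-+ (λ u v → P u v ∧ ⌊ u <? v ⌋) (λ u v → P v u ∧ ⌊ u <? v ⌋) ⟩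
  countPairs P + countPairs (flip P)
    ∎
  where open ≤-Reasoning

restrict : ∀ {m} → (Fin m → Bool) → (Fin m → Fin m → Bool) → Fin m → Fin m → Bool
restrict S R u v = S u ∧ S v ∧ R u v

restrict-irrefl : ∀ {m} (S : Fin m → Bool) R → (∀ u → R u u ≡ false) → ∀ u → restrict S R u u ≡ false
restrict-irrefl S R R-irrefl u with S u
... | true  = R-irrefl u
... | false = refl

restrict-flip : ∀ {m} (S : Fin m → Bool) R → (∀ u v → R u v ≡ R v u) →
  ∀ u v → restrict S R v u ≡ restrict S R u v
restrict-flip S R R-sym u v with S u | S v
... | true  | true  = R-sym v u
... | true  | false = refl
... | false | true  = refl
... | false | false = refl

restrict-cover : ∀ {m} (S : Fin m → Bool) R P → (∀ u v → R u v ≡ true → P u v ≡ true ⊎ P v u ≡ true) →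
  ∀ u v → restrict S R u v ≡ true → restrict S P u v ≡ true ⊎ restrict S P v u ≡ true
restrict-cover S R P cover u v uv∈R with S u | S v
... | true | true = cover u v uv∈R

countRelated-restrict : ∀ {m} (S : Fin m → Bool) R →
  countRelated (restrict S R) ≡ sumFin (λ u → toℕ (S u) * countTrue (λ v → S v ∧ R u v))
countRelated-restrict {m} S R = sumFin-cong row
  where
  row : ∀ u → sumFin (λ v → toℕ (restrict S R u v)) ≡ toℕ (S u) * countTrue (λ v → S v ∧ R u v)
  row u with S u
  ... | true  = sym (trans (*-identityˡ _) (countTrue≡sumFin (λ v → S v ∧ R u v)))
  ... | false = trans (sumFin-const m 0) (*-zeroʳ m)

edgesIn≡countPairs : ∀ G S → edgesIn G S ≡ countPairs (restrict S (adj G))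
edgesIn≡countPairs G S =
  sumFin-cong (λ u → trans (countTrue≡sumFin (λ v → S u ∧ S v ∧ adj G u v ∧ ⌊ u <? v ⌋))
                           (sumFin-cong (λ v → cong toℕ (reassoc u v))))
  where
  reassoc : ∀ u v → S u ∧ S v ∧ adj G u v ∧ ⌊ u <? v ⌋ ≡ restrict S (adj G) u v ∧ ⌊ u <? v ⌋
  reassoc u v = sym (trans (Bool.∧-assoc (S u) _ _) (cong (S u ∧_) (Bool.∧-assoc (S v) _ _)))

degree : (G : Graph) → NodeSet G → Fin (n G) → ℕ
degree G S u = countTrue (λ v → S v ∧ adj G u v)

sumFin-degree≤2*edgesIn : ∀ G S → sumFin (λ u → toℕ (S u) * degree G S u) ≤ 2 * edgesIn G S
sumFin-degree≤2*edgesIn G S = begin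
  sumFin (λ u → toℕ (S u) * degree G S u)  ≡⟨ sym (countRelated-restrict S (adj G)) ⟩
  countRelated E
    ≤⟨ countRelated≤countPairs+countPairsᵀ E (restrict-irrefl S (adj G) (irrefl G)) ⟩
  countPairs E + countPairs (flip E)
    ≡⟨ cong (countPairs E +_) (countRelated-cong (λ u v → cong (_∧ ⌊ u <? v ⌋) (E-sym u v))) ⟩
  countPairs E + countPairs E              ≡⟨ cong (λ e → e + e) (sym (edgesIn≡countPairs G S)) ⟩
  edgesIn G S + edgesIn G S                ≡⟨ cong (edgesIn G S +_) (sym (+-identityʳ _)) ⟩
  2 * edgesIn G S                          ∎
  where
  open ≤-Reasoning
  E : Fin (n G) → Fin (n G) → Bool
  E = restrict S (adj G)

  E-sym : ∀ u v → E v u ≡ E u v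
  E-sym = restrict-flip S (adj G) (Graph.sym G)

Degenerate : Graph → ℕ → Set
Degenerate G d = ∀ S → 0 < size G S → ∃[ u ] S u ≡ true × degree G S u ≤ d

densityBound⇒degenerate : ∀ {G δ} → DensityBound G δ → Degenerate G (2 * δ)
densityBound⇒degenerate {G} {δ} dense S 0<∣S∣
  with any? (λ u → (S u Bool.≟ true) ×-dec (degree G S u ≤? 2 * δ))
... | yes low = low
... | no none = ⊥-elim (<-irrefl refl ∣S∣*[1+2δ]<∣S∣*[1+2δ])
  where
  open ≤-Reasoning
  s : ℕ
  s = size G S

  high : ∀ u → toℕ (S u) * suc (2 * δ) ≤ toℕ (S u) * degree G S u
  high u with S u in u∈S
  ... | true  = *-monoʳ-≤ 1 (≰⇒> (λ deg≤2δ → none (u , u∈S , deg≤2δ)))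
  ... | false = z≤n

  ∣S∣*[1+2δ]<∣S∣*[1+2δ] : s * suc (2 * δ) < s * suc (2 * δ)
  ∣S∣*[1+2δ]<∣S∣*[1+2δ] = begin-strict
    s * suc (2 * δ)                          ≡⟨ sym (sumFin-toℕ-* S _) ⟩
    sumFin (λ u → toℕ (S u) * suc (2 * δ))   ≤⟨ sumFin-mono-≤ high ⟩
    sumFin (λ u → toℕ (S u) * degree G S u)  ≤⟨ sumFin-degree≤2*edgesIn G S ⟩
    2 * edgesIn G S                          ≤⟨ *-monoʳ-≤ 2 (dense S) ⟩
    2 * (δ * s)                              ≡⟨ trans (sym (*-assoc 2 δ s)) (*-comm (2 * δ) s) ⟩
    s * (2 * δ)                              <⟨ *-monoʳ-< s {{>-nonZero 0<∣S∣}} (n<1+n _) ⟩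
    s * suc (2 * δ)                          ∎

record BoundedOrientation (G : Graph) (S : NodeSet G) (d : ℕ) : Set where
  field
    out            : Fin (n G) → Fin (n G) → Bool
    out⇒edge       : ∀ u v → out u v ≡ true → S v ≡ true × adj G u v ≡ true
    out-exactlyOne : ∀ u v → S u ≡ true → S v ≡ true → adj G u v ≡ true →
      (out u v ≡ true × out v u ≡ false) ⊎ (out u v ≡ false × out v u ≡ true)
    out-load≤      : ∀ u → S u ≡ true → countTrue (out u) ≤ d
open BoundedOrientation

emptyOrientation : ∀ {G} (S : NodeSet G) d → size G S ≡ 0 → BoundedOrientation G S d
emptyOrientation S d ∣S∣≡0 = record
  { out            = λ _ _ → false
  ; out⇒edge       = λ _ _ ()
  ; out-exactlyOne = λ u _ u∈S → ⊥-elim (true≢false (trans (sym u∈S) (∉S u)))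
  ; out-load≤      = λ u u∈S → ⊥-elim (true≢false (trans (sym u∈S) (∉S u)))
  }
  where
  ∉S : ∀ u → S u ≡ false
  ∉S = countTrue≡0⇒false S ∣S∣≡0

module _ {G : Graph} {S : NodeSet G} {d : ℕ} (p : Fin (n G)) (p∈S : S p ≡ true)
         (degree≤d : degree G S p ≤ d) (O : BoundedOrientation G (removeNode S p) d) where

  private
    out′ : Fin (n G) → Fin (n G) → Bool
    out′ u v with u ≟ p
    ... | yes _ = S v ∧ adj G p v
    ... | no _  = out O u v

    ¬out-p : ∀ w → out O w p ≡ false
    ¬out-p w with out O w p in wp
    ... | false = refl
    ... | true  = ⊥-elim (true≢false
                    (trans (sym (proj₁ (out⇒edge O w p wp))) (removeNode-self S p)))

    out′⇒edge : ∀ u v → out′ u v ≡ true → S v ≡ true × adj G u v ≡ true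
    out′⇒edge u v uv with u ≟ p
    ... | yes refl = ∧-unzip uv
    ... | no _ with out⇒edge O u v uv
    ...   | v∈S-p , uv∈E = removeNode⊆ S p v v∈S-p , uv∈E

    out′-exactlyOne : ∀ u v → S u ≡ true → S v ≡ true → adj G u v ≡ true →
      (out′ u v ≡ true × out′ v u ≡ false) ⊎ (out′ u v ≡ false × out′ v u ≡ true)
    out′-exactlyOne u v u∈S v∈S uv∈E with u ≟ p | v ≟ p
    ... | yes refl | yes refl = ⊥-elim (true≢false (trans (sym uv∈E) (irrefl G u)))
    ... | yes refl | no _     = inj₁ (cong₂ _∧_ v∈S uv∈E , ¬out-p v)
    ... | no _     | yes refl = inj₂ (¬out-p u , cong₂ _∧_ u∈S (trans (Graph.sym G v u) uv∈E))
    ... | no u≢p   | no v≢p   =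
      out-exactlyOne O u v (trans (removeNode-other S u≢p) u∈S) (trans (removeNode-other S v≢p) v∈S) uv∈E

    out′-load≤ : ∀ u → S u ≡ true → countTrue (out′ u) ≤ d
    out′-load≤ u u∈S with u ≟ p
    ... | yes refl = degree≤d
    ... | no u≢p   = out-load≤ O u (trans (removeNode-other S u≢p) u∈S)

  extendOrientation : BoundedOrientation G S d
  extendOrientation = record
    { out = out′ ; out⇒edge = out′⇒edge ; out-exactlyOne = out′-exactlyOne ; out-load≤ = out′-load≤ }

degenerate⇒orientation : ∀ {G d} → Degenerate G d → ∀ S → BoundedOrientation G S d
degenerate⇒orientation {G} {d} degenerate S = peel (size G S) S refl
  where
  peel : ∀ k S → size G S ≡ k → BoundedOrientation G S d
  peel zero    S ∣S∣≡0   = emptyOrientation S d ∣S∣≡0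
  peel (suc k) S ∣S∣≡1+k with degenerate S (subst (0 <_) (sym ∣S∣≡1+k) (s≤s z≤n))
  ... | p , p∈S , degree≤d = extendOrientation p p∈S degree≤d (peel k (removeNode S p) ∣S-p∣≡k)
    where
    ∣S-p∣≡k : size G (removeNode S p) ≡ k
    ∣S-p∣≡k = suc-injective (trans (sym (countTrue-removeNode S p p∈S)) ∣S∣≡1+k)

module _ {G : Graph} {T : ℕ} (σ : Schedule G T) where

  contacts : Fin (n G) → Fin (n G) → Bool
  contacts u v = any (λ r → does (Maybe.≡-dec _≟_ (initiate σ r u) (just v)))

  countTrue-contacts≤T : ∀ u → countTrue (contacts u) ≤ T
  countTrue-contacts≤T u = begin
    countTrue (contacts u)
      ≡⟨ countTrue≡sumFin (contacts u) ⟩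
    sumFin (λ v → toℕ (contacts u v))
      ≤⟨ sumFin-mono-≤ (λ v → toℕ-any≤countTrue (λ r → exchange r v)) ⟩
    sumFin (λ v → countTrue (λ r → exchange r v))
      ≡⟨ sumFin-cong (λ v → countTrue≡sumFin (λ r → exchange r v)) ⟩
    sumFin (λ v → sumFin (λ r → toℕ (exchange r v)))
      ≡⟨ sumFin-swap (λ v r → toℕ (exchange r v)) ⟩
    sumFin (λ r → sumFin (λ v → toℕ (exchange r v)))
      ≡⟨ sumFin-cong (λ r → sym (countTrue≡sumFin (exchange r))) ⟩
    sumFin (λ r → countTrue (exchange r))
      ≤⟨ sumFin-mono-≤ (λ r → countTrue-≟just≤1 (initiate σ r u)) ⟩
    sumFin {T} (λ _ → 1)
      ≡⟨ trans (sumFin-const T 1) (*-identityʳ T) ⟩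
    T ∎
    where
    open ≤-Reasoning
    exchange : Fin T → Fin (n G) → Bool
    exchange r v = does (Maybe.≡-dec _≟_ (initiate σ r u) (just v))

  contacts-cover : SolvesNeighborExchange G T σ →
    ∀ u v → adj G u v ≡ true → contacts u v ≡ true ⊎ contacts v u ≡ true
  contacts-cover solves u v uv∈E with solves u v uv∈E
  ... | r , inj₁ u→v = inj₁ (any-intro _ r (dec-true (Maybe.≡-dec _≟_ _ (just v)) u→v))
  ... | r , inj₂ v→u = inj₂ (any-intro _ r (dec-true (Maybe.≡-dec _≟_ _ (just u)) v→u))

  solvesNeighborExchange⇒densityBound : SolvesNeighborExchange G T σ → DensityBound G T
  solvesNeighborExchange⇒densityBound solves S = begin
    edgesIn G S                         ≡⟨ edgesIn≡countPairs G S ⟩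
    countPairs (restrict S (adj G))
      ≤⟨ countPairs-cover _ C (restrict-cover S (adj G) contacts (contacts-cover solves)) ⟩
    countPairs C + countPairs (flip C)  ≤⟨ countPairs+countPairsᵀ≤countRelated C ⟩
    countRelated C                      ≡⟨ countRelated-restrict S contacts ⟩
    sumFin (λ u → toℕ (S u) * countTrue (λ v → S v ∧ contacts u v))
      ≤⟨ sumFin-mono-≤ (λ u → *-monoʳ-≤ (toℕ (S u))
           (≤-trans (countTrue-mono {f = λ v → S v ∧ contacts u v} (λ v → proj₂ ∘ ∧-unzip))
                    (countTrue-contacts≤T u))) ⟩
    sumFin (λ u → toℕ (S u) * T)        ≡⟨ sumFin-toℕ-* S T ⟩
    size G S * T                        ≡⟨ *-comm (size G S) T ⟩
    T * size G S                        ∎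
    where
    open ≤-Reasoning
    C : Fin (n G) → Fin (n G) → Bool
    C = restrict S contacts

lemma3 : (G : Graph) (δ : ℕ) → IsHereditaryDensity G δ →
    ((T : ℕ) (σ : Schedule G T) → SolvesNeighborExchange G T σ → δ ≤ T)
    × Σ (InitiatorAssignment G) (λ a → ∀ u → load G a u ≤ 2 * δ)
lemma3 G δ (dense , minimal) =
  (λ T σ solves → minimal T (solvesNeighborExchange⇒densityBound σ solves)) ,
  (assignment , λ u → out-load≤ O u refl)
  where
  O : BoundedOrientation G (λ _ → true) (2 * δ)
  O = degenerate⇒orientation (densityBound⇒degenerate {G} {δ} dense) (λ _ → true)

  assignment : InitiatorAssignment G
  assignment = record
    { init       = out O
    ; onlyEdges  = λ u v uv → proj₂ (out⇒edge O u v uv)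
    ; exactlyOne = λ u v → out-exactlyOne O u v refl refl
    }
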